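{- Let $q$ be a prime power, $1\neq\sigma\in\mathrm{Aut}(\mathbb F_q)$ with fixed field $\mathbb F_s$, $V^*=\mathbb F_q^{n+1}$ (row vectors), and let $M\in M_{n+1}(q)$ be invertible. Then: (1) if $W$ is a vector subspace of $V^*$ such that $[\xi^\sigma]=[\xi M]$ for all nonzero $\xi\in W$, then $\dim W\leq1$; (2) if $U$ is a subspace of $V^*$ with $\dim U=2$, then $\mathrm{PG}(U)$ contains at most $s+1$ points $[\xi]$ such that $[\xi^\sigma]=[\xi M]$.
   Context: $\xi^\sigma$ is $\xi$ with $\sigma$ applied to each coordinate; $[\eta]$ is the projective point of a nonzero vector $\eta$, so $[\xi^\sigma]=[\xi M]$ means $\xi M$ is a nonzero scalar multiple of $\xi^\sigma$. -}

module Defs where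

open import Level using (0ℓ)
open import Data.Nat using (ℕ; suc)
open import Data.Fin using (Fin; zero; suc)
open import Data.Product using (Σ; ∃; _×_; _,_)
open import Function.Bundles using (_↔_)
open import Relation.Binary.PropositionalEquality using (_≡_; _≢_)
open import Relation.Nullary using (¬_)
open import Algebra.Structures using (IsCommutativeRing)

-- A finite field: a commutative ring (with propositional equality) in which
-- 0 ≠ 1 and every nonzero element has a multiplicative inverse, and whose
-- carrier is in bijection with Fin q for some q (q is then a prime power).
record FiniteField : Set₁ where
  infixl 6 _+_
  infixl 7 _*_
  field
    F        : Set
    _+_ _*_  : F → F → F
    -_       : F → F
    0# 1#    : F
    isCommutativeRing : IsCommutativeRing _≡_ _+_ _*_ -_ 0# 1#
    0≢1      : 0# ≢ 1#
    inverse  : ∀ x → x ≢ 0# → Σ F (λ y → x * y ≡ 1#)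
    q        : ℕ
    enum     : F ↔ Fin q

module _ (K : FiniteField) where
  open FiniteField K

  record IsAutomorphism (σ : F → F) : Set where
    field
      hom-+  : ∀ x y → σ (x + y) ≡ σ x + σ y
      hom-*  : ∀ x y → σ (x * y) ≡ σ x * σ y
      hom-1  : σ 1# ≡ 1#
      bij    : Σ (F → F) (λ τ → (∀ x → τ (σ x) ≡ x) × (∀ x → σ (τ x) ≡ x))

  Fix : (F → F) → Set
  Fix σ = Σ F (λ x → σ x ≡ x)

  Vect : ℕ → Set
  Vect m = Fin m → F

  Mat : ℕ → Set
  Mat m = Fin m → Fin m → F

  sumF : ∀ {m} → (Fin m → F) → F
  sumF {ℕ.zero} f = 0#
  sumF {suc m}  f = f zero + sumF (λ i → f (suc i))

  _≈ᵥ_ : ∀ {m} → Vect m → Vect m → Set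
  ξ ≈ᵥ η = ∀ i → ξ i ≡ η i

  0ᵥ : ∀ {m} → Vect m
  0ᵥ _ = 0#

  _+ᵥ_ : ∀ {m} → Vect m → Vect m → Vect m
  (ξ +ᵥ η) i = ξ i + η i

  _·_ : ∀ {m} → F → Vect m → Vect m
  (c · ξ) i = c * ξ i

  NonZero : ∀ {m} → Vect m → Set
  NonZero ξ = ¬ (ξ ≈ᵥ 0ᵥ)

  _^ᵛ_ : ∀ {m} → Vect m → (F → F) → Vect m
  (ξ ^ᵛ σ) i = σ (ξ i)

  _⋆_ : ∀ {m} → Vect m → Mat m → Vect m
  (ξ ⋆ M) j = sumF (λ i → ξ i * M i j)

  _⊗_ : ∀ {m} → Mat m → Mat m → Mat m
  (A ⊗ B) i k = sumF (λ j → A i j * B j k)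

  Id : ∀ {m} → Mat m
  Id i j with Data.Fin._≟_ i j
  ... | Relation.Nullary.yes _ = 1#
  ... | Relation.Nullary.no  _ = 0#

  Invertible : ∀ {m} → Mat m → Set
  Invertible {m} M = Σ (Mat m) (λ N → (∀ i j → (M ⊗ N) i j ≡ Id i j)
                                      × (∀ i j → (N ⊗ M) i j ≡ Id i j))

  SamePoint : ∀ {m} → Vect m → Vect m → Set
  SamePoint ξ η = Σ F (λ c → c ≢ 0# × ξ ≈ᵥ (c · η))

  Cond : ∀ {m} → (F → F) → Mat m → Vect m → Set
  Cond σ M ξ = SamePoint (ξ ⋆ M) (ξ ^ᵛ σ)

  record IsSubspace {m} (W : Vect m → Set) : Set where
    field
      zero-mem : W 0ᵥ
      +-closed : ∀ ξ η → W ξ → W η → W (ξ +ᵥ η)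
      ·-closed : ∀ c ξ → W ξ → W (c · ξ)
      resp-≈   : ∀ ξ η → ξ ≈ᵥ η → W ξ → W η

  LinIndep₂ : ∀ {m} → Vect m → Vect m → Set
  LinIndep₂ ξ η = ∀ a b → ((a · ξ) +ᵥ (b · η)) ≈ᵥ 0ᵥ → (a ≡ 0#) × (b ≡ 0#)

  DimAtMost1 : ∀ {m} → (Vect m → Set) → Set
  DimAtMost1 {m} W = ∀ (ξ η : Vect m) → W ξ → W η → ¬ LinIndep₂ ξ η

  Dim2 : ∀ {m} → (Vect m → Set) → Set
  Dim2 {m} U = Σ (Vect m) λ u → Σ (Vect m) λ v → LinIndep₂ u v
             × (∀ ξ → (U ξ → Σ F (λ a → Σ F (λ b → ξ ≈ᵥ ((a · u) +ᵥ (b · v)))))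
                    × (∀ a b → ξ ≈ᵥ ((a · u) +ᵥ (b · v)) → U ξ))

{-# OPTIONS --safe #-}

-- Let ξ₁ M = c₁ ξ₁^σ and ξ₂ M = c₂ ξ₂^σ with ξ₁, ξ₂ independent. If ξ = α ξ₁ + β ξ₂ also
-- satisfies ξ M = c ξ^σ then, since ξ₁^σ and ξ₂^σ are again independent, comparing
-- coefficients gives α c₁ = c σ(α) and β c₂ = c σ(β).
-- (1) For ξ = ξ₁ + t ξ₂ this forces c = c₁ = c₂ and then σ(t) = t for every t, contradicting σ ≠ 1.
-- (2) For two such points ξ, ξ₀ on a line it makes the cross ratio (α β₀)/(β α₀) fixed by σ;
-- since the cross ratio determines [ξ], the points other than [ξ₁] inject into F_s.

module Submission where

open import Defs hiding (_≈ᵥ_; _·_; _^ᵛ_; _⋆_)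
open import Level using (0ℓ)
open import Data.Nat using (ℕ; suc; _≤_; z≤n; s≤s)
open import Data.Nat.Properties using (≤-trans)
open import Data.Fin using (Fin; zero; suc; _<_)
open import Data.Fin.Properties using (inj⇒≟; injective⇒≤; <-cmp; toℕ<n)
open import Data.Product using (Σ; _×_; _,_; proj₁; proj₂)
open import Data.Empty using (⊥-elim)
open import Data.List using (List; []; _∷_; length; lookup)
open import Data.List.Relation.Unary.All as All using (All; []; _∷_)
open import Data.List.Relation.Unary.AllPairs using (AllPairs; []; _∷_)
open import Data.List.Membership.Propositional.Properties using (∈-lookup)
open import Function.Bundles using (_↔_; Inverse; Injection)
open import Function.Properties.Inverse using (↔⇒↣)
open import Relation.Nullary using (¬_; yes; no)
open import Relation.Binary.Definitions using (DecidableEquality; tri<; tri≈; tri>)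
open import Relation.Binary.PropositionalEquality
open import Algebra.Bundles using (CommutativeRing)

module _ {A : Set} {R : A → A → Set} where

  AllPairs-lookup : ∀ {xs} → AllPairs R xs → ∀ {i j} → i < j → R (lookup xs i) (lookup xs j)
  AllPairs-lookup (Rx ∷ _)   {zero}  {suc j} _         = All.lookup Rx (∈-lookup j)
  AllPairs-lookup (_ ∷ Rxs)  {suc i} {suc j} (s≤s i<j) = AllPairs-lookup Rxs i<j

module _ {A B : Set} {k : ℕ} (B↔Fin : B ↔ Fin k) {P : A → Set} {_∼_ : A → A → Set}
         (f : ∀ {x} → P x → B) (f-injective : ∀ {x y} (p : P x) (q : P y) → f p ≡ f q → x ∼ y) where

  separated⇒length≤ : ∀ {xs} → All P xs → AllPairs (λ x y → ¬ x ∼ y) xs → length xs ≤ k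
  separated⇒length≤ {xs} ps separated = injective⇒≤ g-injective
    where
    f-at : (i : Fin (length xs)) → B
    f-at i = f (All.lookup ps (∈-lookup i))

    g-injective : ∀ {i j} → Inverse.to B↔Fin (f-at i) ≡ Inverse.to B↔Fin (f-at j) → i ≡ j
    g-injective {i} {j} gi≡gj with <-cmp i j | Injection.injective (↔⇒↣ B↔Fin) gi≡gj
    ... | tri< i<j _ _ | fi≡fj = ⊥-elim (AllPairs-lookup separated i<j (f-injective _ _ fi≡fj))
    ... | tri≈ _ i≡j _ | _     = i≡j
    ... | tri> _ _ j<i | fi≡fj = ⊥-elim (AllPairs-lookup separated j<i (f-injective _ _ (sym fi≡fj)))

module FieldProperties (K : FiniteField) where
  open FiniteField K public
  open ≡-Reasoning

  commutativeRing : CommutativeRing 0ℓ 0ℓ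
  commutativeRing = record { isCommutativeRing = isCommutativeRing }

  open CommutativeRing commutativeRing public
    using (_-_; +-comm; +-identityˡ; +-identityʳ; *-assoc; *-comm; *-identityˡ; *-identityʳ; zeroˡ; zeroʳ)
  open import Algebra.Properties.Ring (CommutativeRing.ring commutativeRing) public
    using ( x+x≈x⇒x≈0; [y-z]x≈yx-zx; -‿distribˡ-*; x∙y⁻¹≈ε⇒x≈y; x≈y⇒x∙y⁻¹≈ε
          ; +-inverseˡ-unique; ⁻¹-anti-homo‿-; -‿+-comm )
  open import Algebra.Solver.Ring.NaturalCoefficients.Default (CommutativeRing.commutativeSemiring commutativeRing) public
    using (solve; _:+_; _:*_; _:=_)

  _≟_ : DecidableEquality F
  _≟_ = inj⇒≟ (↔⇒↣ enum)

  [p-q]+[r-s]≡[p+r]-[q+s] : ∀ p q r s → (p - q) + (r - s) ≡ (p + r) - (q + s)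
  [p-q]+[r-s]≡[p+r]-[q+s] p q r s = begin
    (p + - q) + (r + - s)
      ≡⟨ solve 4 (λ p q′ r s′ → (p :+ q′) :+ (r :+ s′) := (p :+ r) :+ (q′ :+ s′)) refl p (- q) r (- s) ⟩
    (p + r) + (- q + - s)
      ≡⟨ cong ((p + r) +_) (-‿+-comm q s) ⟩
    (p + r) + - (q + s)
      ∎

  x+y≡x′+y′⇒x-x′≡y′-y : ∀ {x y x′ y′} → x + y ≡ x′ + y′ → x - x′ ≡ y′ - y
  x+y≡x′+y′⇒x-x′≡y′-y {x} {y} {x′} {y′} e = trans
    (+-inverseˡ-unique _ _ (trans ([p-q]+[r-s]≡[p+r]-[q+s] x x′ y y′) (x≈y⇒x∙y⁻¹≈ε e)))
    (⁻¹-anti-homo‿- y y′)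

  [a-a′]x+[b-b′]y≡[ax+by]-[a′x+b′y] : ∀ a a′ b b′ x y →
                                      (a - a′) * x + (b - b′) * y ≡ (a * x + b * y) - (a′ * x + b′ * y)
  [a-a′]x+[b-b′]y≡[ax+by]-[a′x+b′y] a a′ b b′ x y =
    trans (cong₂ _+_ ([y-z]x≈yx-zx x a a′) ([y-z]x≈yx-zx y b b′)) ([p-q]+[r-s]≡[p+r]-[q+s] _ _ _ _)

  inv : ∀ x → x ≢ 0# → F
  inv x x≢0 = proj₁ (inverse x x≢0)

  *-inverseʳ : ∀ {x} (x≢0 : x ≢ 0#) → x * inv x x≢0 ≡ 1#
  *-inverseʳ {x} x≢0 = proj₂ (inverse x x≢0)

  *-inverseˡ : ∀ {x} (x≢0 : x ≢ 0#) → inv x x≢0 * x ≡ 1#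
  *-inverseˡ x≢0 = trans (*-comm _ _) (*-inverseʳ x≢0)

  x*y≡z⇒y≡x⁻¹*z : ∀ {x y z} (x≢0 : x ≢ 0#) → x * y ≡ z → y ≡ inv x x≢0 * z
  x*y≡z⇒y≡x⁻¹*z {x} {y} {z} x≢0 e = begin
    y                      ≡⟨ sym (*-identityˡ y) ⟩
    1# * y                 ≡⟨ cong (_* y) (sym (*-inverseˡ x≢0)) ⟩
    inv x x≢0 * x * y      ≡⟨ *-assoc _ _ _ ⟩
    inv x x≢0 * (x * y)    ≡⟨ cong (inv x x≢0 *_) e ⟩
    inv x x≢0 * z          ∎

  *-cancelˡ : ∀ {x y z} → x ≢ 0# → x * y ≡ x * z → y ≡ z
  *-cancelˡ x≢0 e = trans (x*y≡z⇒y≡x⁻¹*z x≢0 e) (sym (x*y≡z⇒y≡x⁻¹*z x≢0 refl))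

  x*y≡0⇒y≡0 : ∀ {x y} → x ≢ 0# → x * y ≡ 0# → y ≡ 0#
  x*y≡0⇒y≡0 x≢0 e = *-cancelˡ x≢0 (trans e (sym (zeroʳ _)))

  *-≢0 : ∀ {x y} → x ≢ 0# → y ≢ 0# → x * y ≢ 0#
  *-≢0 x≢0 y≢0 e = y≢0 (x*y≡0⇒y≡0 x≢0 e)

  x*y*y⁻¹≡x : ∀ {x y} (y≢0 : y ≢ 0#) → x * y * inv y y≢0 ≡ x
  x*y*y⁻¹≡x {x} y≢0 = trans (*-assoc _ _ _) (trans (cong (x *_) (*-inverseʳ y≢0)) (*-identityʳ x))

  x*y⁻¹*y≡x : ∀ {x y} (y≢0 : y ≢ 0#) → x * inv y y≢0 * y ≡ x
  x*y⁻¹*y≡x {x} {y} y≢0 =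
    trans (solve 3 (λ x y y⁻¹ → x :* y⁻¹ :* y := x :* y :* y⁻¹) refl x y (inv y y≢0)) (x*y*y⁻¹≡x y≢0)

  x*y⁻¹≡x′*y′⁻¹⇒x*y′≡x′*y : ∀ {x y x′ y′} (y≢0 : y ≢ 0#) (y′≢0 : y′ ≢ 0#) →
                            x * inv y y≢0 ≡ x′ * inv y′ y′≢0 → x * y′ ≡ x′ * y
  x*y⁻¹≡x′*y′⁻¹⇒x*y′≡x′*y {x} {y} {x′} {y′} y≢0 y′≢0 e = begin
    x * y′                      ≡⟨ cong (_* y′) (sym (x*y⁻¹*y≡x y≢0)) ⟩
    x * inv y y≢0 * y * y′      ≡⟨ cong (λ t → t * y * y′) e ⟩
    x′ * inv y′ y′≢0 * y * y′
      ≡⟨ solve 3 (λ t y y′ → t :* y :* y′ := t :* y′ :* y) refl (x′ * inv y′ y′≢0) y y′ ⟩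
    x′ * inv y′ y′≢0 * y′ * y   ≡⟨ cong (_* y) (x*y⁻¹*y≡x y′≢0) ⟩
    x′ * y                      ∎

module VectorProperties (K : FiniteField) where
  open FieldProperties K
  open ≡-Reasoning

  infix 4 _≈ᵥ_

  _≈ᵥ_ : ∀ {m} → Vect K m → Vect K m → Set
  _≈ᵥ_ = Defs._≈ᵥ_ K

  _·_ : ∀ {m} → F → Vect K m → Vect K m
  _·_ = Defs._·_ K

  _^ᵛ_ : ∀ {m} → Vect K m → (F → F) → Vect K m
  _^ᵛ_ = Defs._^ᵛ_ K

  _⋆_ : ∀ {m} → Vect K m → Mat K m → Vect K m
  _⋆_ = Defs._⋆_ K

  comb : ∀ {m} → F → Vect K m → F → Vect K m → Vect K m
  comb a ξ b η = _+ᵥ_ K (a · ξ) (b · η)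

  InSpan : ∀ {m} → Vect K m → Vect K m → Vect K m → Set
  InSpan u v ξ = Σ F λ a → Σ F λ b → ξ ≈ᵥ comb a u b v

  sumF-cong : ∀ {m} {f g : Fin m → F} → (∀ i → f i ≡ g i) → sumF K f ≡ sumF K g
  sumF-cong {ℕ.zero} f≗g = refl
  sumF-cong {suc m}  f≗g = cong₂ _+_ (f≗g zero) (sumF-cong (λ i → f≗g (suc i)))

  sumF-comb : ∀ {m} a b (f g : Fin m → F) →
              sumF K (λ i → a * f i + b * g i) ≡ a * sumF K f + b * sumF K g
  sumF-comb {ℕ.zero} a b f g = sym (trans (cong₂ _+_ (zeroʳ a) (zeroʳ b)) (+-identityʳ 0#))
  sumF-comb {suc m}  a b f g = begin
    (a * x + b * y) + sumF K (λ i → a * f (suc i) + b * g (suc i))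
      ≡⟨ cong ((a * x + b * y) +_) (sumF-comb a b (λ i → f (suc i)) (λ i → g (suc i))) ⟩
    (a * x + b * y) + (a * S + b * T)
      ≡⟨ solve 6 (λ a b x y S T → (a :* x :+ b :* y) :+ (a :* S :+ b :* T) := a :* (x :+ S) :+ b :* (y :+ T)) refl a b x y S T ⟩
    a * (x + S) + b * (y + T) ∎
    where
    x = f zero
    y = g zero
    S = sumF K (λ i → f (suc i))
    T = sumF K (λ i → g (suc i))

  ⋆-cong : ∀ {m} (M : Mat K m) {ξ η : Vect K m} → ξ ≈ᵥ η → (ξ ⋆ M) ≈ᵥ (η ⋆ M)
  ⋆-cong M ξ≈η j = sumF-cong (λ i → cong (_* M i j) (ξ≈η i))

  ⋆-comb : ∀ {m} (M : Mat K m) a b (ξ η : Vect K m) → (comb a ξ b η ⋆ M) ≈ᵥ comb a (ξ ⋆ M) b (η ⋆ M)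
  ⋆-comb M a b ξ η j = trans
    (sumF-cong (λ i → solve 5 (λ a b x y m → (a :* x :+ b :* y) :* m := a :* (x :* m) :+ b :* (y :* m))
                              refl a b (ξ i) (η i) (M i j)))
    (sumF-comb a b (λ i → ξ i * M i j) (λ i → η i * M i j))

  LinIndep₂-unique : ∀ {m} {ξ η : Vect K m} {a b a′ b′} → LinIndep₂ K ξ η →
                     comb a ξ b η ≈ᵥ comb a′ ξ b′ η → a ≡ a′ × b ≡ b′
  LinIndep₂-unique {a = a} {b} {a′} {b′} indep same
    with indep (a - a′) (b - b′)
               (λ i → trans ([a-a′]x+[b-b′]y≡[ax+by]-[a′x+b′y] a a′ b b′ _ _) (x≈y⇒x∙y⁻¹≈ε (same i)))
  ... | a-a′≡0 , b-b′≡0 = x∙y⁻¹≈ε⇒x≈y a a′ a-a′≡0 , x∙y⁻¹≈ε⇒x≈y b b′ b-b′≡0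

  comb-0ʳ : ∀ {m} a b (ξ η : Vect K m) → b ≡ 0# → comb a ξ b η ≈ᵥ (a · ξ)
  comb-0ʳ a b ξ η b≡0 i = trans (cong (a * ξ i +_) (trans (cong (_* η i) b≡0) (zeroˡ (η i)))) (+-identityʳ _)

  comb-0ˡ : ∀ {m} a b (ξ η : Vect K m) → a ≡ 0# → comb a ξ b η ≈ᵥ (b · η)
  comb-0ˡ a b ξ η a≡0 i = trans (cong (_+ b * η i) (trans (cong (_* ξ i) a≡0) (zeroˡ (ξ i)))) (+-identityˡ _)

  LinIndep₂-·≈· : ∀ {m} {ξ η : Vect K m} {a b} → LinIndep₂ K ξ η → (a · ξ) ≈ᵥ (b · η) → a ≡ 0# × b ≡ 0#
  LinIndep₂-·≈· {ξ = ξ} {η} {a} {b} indep aξ≈bη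
    with LinIndep₂-unique indep (λ i → trans (comb-0ʳ a 0# ξ η refl i) (trans (aξ≈bη i) (sym (comb-0ˡ 0# b ξ η refl i))))
  ... | a≡0 , 0≡b = a≡0 , sym 0≡b

  LinIndep₂-sym : ∀ {m} {ξ η : Vect K m} → LinIndep₂ K ξ η → LinIndep₂ K η ξ
  LinIndep₂-sym indep a b aη+bξ≈0 with indep b a (λ i → trans (+-comm _ _) (aη+bξ≈0 i))
  ... | b≡0 , a≡0 = a≡0 , b≡0

  LinIndep₂⇒NonZeroˡ : ∀ {m} {ξ η : Vect K m} → LinIndep₂ K ξ η → NonZero K ξ
  LinIndep₂⇒NonZeroˡ {ξ = ξ} {η} indep ξ≈0 = 0≢1 (sym (proj₁ (indep 1# 0# λ i →
    trans (comb-0ʳ 1# 0# ξ η refl i) (trans (cong (1# *_) (ξ≈0 i)) (zeroʳ 1#)))))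

  LinIndep₂⇒NonZeroʳ : ∀ {m} {ξ η : Vect K m} → LinIndep₂ K ξ η → NonZero K η
  LinIndep₂⇒NonZeroʳ indep = LinIndep₂⇒NonZeroˡ (LinIndep₂-sym indep)

  ≈·⇒SamePoint : ∀ {m} {ξ η : Vect K m} {k} → NonZero K ξ → ξ ≈ᵥ (k · η) → SamePoint K ξ η
  ≈·⇒SamePoint {η = η} {k} ξ≢0 ξ≈kη = k , k≢0 , ξ≈kη
    where
    k≢0 : k ≢ 0#
    k≢0 k≡0 = ξ≢0 (λ i → trans (ξ≈kη i) (trans (cong (_* η i) k≡0) (zeroˡ (η i))))

  SamePoint-sym : ∀ {m} {ξ η : Vect K m} → NonZero K η → SamePoint K ξ η → SamePoint K η ξ
  SamePoint-sym η≢0 (c , c≢0 , ξ≈cη) = ≈·⇒SamePoint η≢0 (λ i → x*y≡z⇒y≡x⁻¹*z c≢0 (sym (ξ≈cη i)))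

  ¬SamePoint⇒LinIndep₂ : ∀ {m} {ξ η : Vect K m} → NonZero K ξ → NonZero K η → ¬ SamePoint K ξ η → LinIndep₂ K ξ η
  ¬SamePoint⇒LinIndep₂ {ξ = ξ} {η} ξ≢0 η≢0 ¬ξ~η a b aξ+bη≈0 with a ≟ 0#
  ... | no a≢0 = ⊥-elim (¬ξ~η (≈·⇒SamePoint ξ≢0 λ i → begin
    ξ i                       ≡⟨ x*y≡z⇒y≡x⁻¹*z a≢0 (+-inverseˡ-unique _ _ (aξ+bη≈0 i)) ⟩
    inv a a≢0 * - (b * η i)   ≡⟨ cong (inv a a≢0 *_) (-‿distribˡ-* b (η i)) ⟩
    inv a a≢0 * (- b * η i)   ≡⟨ sym (*-assoc _ _ _) ⟩
    inv a a≢0 * - b * η i     ∎))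
  ... | yes a≡0 with b ≟ 0#
  ...   | yes b≡0 = a≡0 , b≡0
  ...   | no b≢0  = ⊥-elim (η≢0 λ i → x*y≡0⇒y≡0 b≢0 (trans (sym (comb-0ˡ a b ξ η a≡0 i)) (aξ+bη≈0 i)))

  proportional⇒SamePoint : ∀ {m} {ξ₁ ξ₂ ξ ξ′ : Vect K m} {α β α′ β′} → NonZero K ξ → β′ ≢ 0# →
                           ξ ≈ᵥ comb α ξ₁ β ξ₂ → ξ′ ≈ᵥ comb α′ ξ₁ β′ ξ₂ → α * β′ ≡ α′ * β →
                           SamePoint K ξ ξ′
  proportional⇒SamePoint {ξ₁ = ξ₁} {ξ₂} {ξ} {ξ′} {α} {β} {α′} {β′} ξ≢0 β′≢0 ξ≈ ξ′≈ αβ′≡α′β =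
    ≈·⇒SamePoint ξ≢0 λ i → begin
      ξ i
        ≡⟨ ξ≈ i ⟩
      α * ξ₁ i + β * ξ₂ i
        ≡⟨ cong₂ (λ p q → p * ξ₁ i + q * ξ₂ i) (sym (x*y*y⁻¹≡x β′≢0)) (sym (x*y*y⁻¹≡x β′≢0)) ⟩
      α * β′ * β′⁻¹ * ξ₁ i + β * β′ * β′⁻¹ * ξ₂ i
        ≡⟨ cong (λ p → p * β′⁻¹ * ξ₁ i + β * β′ * β′⁻¹ * ξ₂ i) αβ′≡α′β ⟩
      α′ * β * β′⁻¹ * ξ₁ i + β * β′ * β′⁻¹ * ξ₂ i
        ≡⟨ solve 6 (λ α′ β β′ β′⁻¹ x y → α′ :* β :* β′⁻¹ :* x :+ β :* β′ :* β′⁻¹ :* y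
                                      := β :* β′⁻¹ :* (α′ :* x :+ β′ :* y)) refl α′ β β′ β′⁻¹ (ξ₁ i) (ξ₂ i) ⟩
      β * β′⁻¹ * (α′ * ξ₁ i + β′ * ξ₂ i)
        ≡⟨ cong (β * β′⁻¹ *_) (sym (ξ′≈ i)) ⟩
      β * β′⁻¹ * ξ′ i
        ∎
    where
    β′⁻¹ = inv β′ β′≢0

  LinIndep₂⇒det≢0 : ∀ {m} {u v ξ₁ ξ₂ : Vect K m} {a₁ b₁ a₂ b₂} → LinIndep₂ K ξ₁ ξ₂ →
                    ξ₁ ≈ᵥ comb a₁ u b₁ v → ξ₂ ≈ᵥ comb a₂ u b₂ v → a₁ * b₂ - a₂ * b₁ ≢ 0#
  LinIndep₂⇒det≢0 {u = u} {v} {ξ₁} {ξ₂} {a₁} {b₁} {a₂} {b₂} indep ξ₁≈ ξ₂≈ det≡0 =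
    LinIndep₂⇒NonZeroˡ indep λ i →
      trans (ξ₁≈ i) (trans (comb-0ˡ a₁ b₁ u v a₁≡0 i) (trans (cong (_* v i) b₁≡0) (zeroˡ (v i))))
    where
    a₁b₂≡a₂b₁ : a₁ * b₂ ≡ a₂ * b₁
    a₁b₂≡a₂b₁ = x∙y⁻¹≈ε⇒x≈y _ _ det≡0

    b₂ξ₁≈b₁ξ₂ : (b₂ · ξ₁) ≈ᵥ (b₁ · ξ₂)
    b₂ξ₁≈b₁ξ₂ i rewrite ξ₁≈ i | ξ₂≈ i = begin
      b₂ * (a₁ * u i + b₁ * v i)
        ≡⟨ solve 5 (λ a₁ b₁ b₂ x y → b₂ :* (a₁ :* x :+ b₁ :* y) := a₁ :* b₂ :* x :+ b₁ :* (b₂ :* y))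
                   refl a₁ b₁ b₂ (u i) (v i) ⟩
      a₁ * b₂ * u i + b₁ * (b₂ * v i)
        ≡⟨ cong (λ p → p * u i + b₁ * (b₂ * v i)) a₁b₂≡a₂b₁ ⟩
      a₂ * b₁ * u i + b₁ * (b₂ * v i)
        ≡⟨ solve 5 (λ a₂ b₁ b₂ x y → a₂ :* b₁ :* x :+ b₁ :* (b₂ :* y) := b₁ :* (a₂ :* x :+ b₂ :* y))
                   refl a₂ b₁ b₂ (u i) (v i) ⟩
      b₁ * (a₂ * u i + b₂ * v i)
        ∎

    a₂ξ₁≈a₁ξ₂ : (a₂ · ξ₁) ≈ᵥ (a₁ · ξ₂)
    a₂ξ₁≈a₁ξ₂ i rewrite ξ₁≈ i | ξ₂≈ i = begin
      a₂ * (a₁ * u i + b₁ * v i)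
        ≡⟨ solve 5 (λ a₁ b₁ a₂ x y → a₂ :* (a₁ :* x :+ b₁ :* y) := a₁ :* (a₂ :* x) :+ a₂ :* b₁ :* y)
                   refl a₁ b₁ a₂ (u i) (v i) ⟩
      a₁ * (a₂ * u i) + a₂ * b₁ * v i
        ≡⟨ cong (λ p → a₁ * (a₂ * u i) + p * v i) (sym a₁b₂≡a₂b₁) ⟩
      a₁ * (a₂ * u i) + a₁ * b₂ * v i
        ≡⟨ solve 5 (λ a₁ a₂ b₂ x y → a₁ :* (a₂ :* x) :+ a₁ :* b₂ :* y := a₁ :* (a₂ :* x :+ b₂ :* y))
                   refl a₁ a₂ b₂ (u i) (v i) ⟩
      a₁ * (a₂ * u i + b₂ * v i)
        ∎

    b₁≡0 : b₁ ≡ 0#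
    b₁≡0 = proj₂ (LinIndep₂-·≈· indep b₂ξ₁≈b₁ξ₂)

    a₁≡0 : a₁ ≡ 0#
    a₁≡0 = proj₂ (LinIndep₂-·≈· indep a₂ξ₁≈a₁ξ₂)

  span₂-exchange : ∀ {m} {u v ξ₁ ξ₂ ξ : Vect K m} → LinIndep₂ K ξ₁ ξ₂ →
                   InSpan u v ξ₁ → InSpan u v ξ₂ → InSpan u v ξ → InSpan ξ₁ ξ₂ ξ
  span₂-exchange {u = u} {v} {ξ₁} {ξ₂} {ξ} indep (a₁ , b₁ , ξ₁≈) (a₂ , b₂ , ξ₂≈) (a , b , ξ≈) =
    D⁻¹ * A , D⁻¹ * B , λ i → begin
      ξ i
        ≡⟨ x*y≡z⇒y≡x⁻¹*z D≢0 (cramer i) ⟩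
      D⁻¹ * (A * ξ₁ i + B * ξ₂ i)
        ≡⟨ solve 5 (λ d A B x y → d :* (A :* x :+ B :* y) := d :* A :* x :+ d :* B :* y) refl D⁻¹ A B (ξ₁ i) (ξ₂ i) ⟩
      D⁻¹ * A * ξ₁ i + D⁻¹ * B * ξ₂ i
        ∎
    where
    D A B : F
    D = a₁ * b₂ - a₂ * b₁
    A = a * b₂ - a₂ * b
    B = a₁ * b - a * b₁

    D≢0 : D ≢ 0#
    D≢0 = LinIndep₂⇒det≢0 indep ξ₁≈ ξ₂≈

    D⁻¹ : F
    D⁻¹ = inv D D≢0

    -- Cramer's rule D ξ = A ξ₁ + B ξ₂, first in subtraction-free form so that the semiring solver applies.
    balanced : ∀ i → a₁ * b₂ * ξ i + (a₂ * b * ξ₁ i + a * b₁ * ξ₂ i)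
                   ≡ a₂ * b₁ * ξ i + (a * b₂ * ξ₁ i + a₁ * b * ξ₂ i)
    balanced i rewrite ξ≈ i | ξ₁≈ i | ξ₂≈ i = solve 8 (λ a b a₁ b₁ a₂ b₂ x y →
        a₁ :* b₂ :* (a :* x :+ b :* y) :+ (a₂ :* b :* (a₁ :* x :+ b₁ :* y) :+ a :* b₁ :* (a₂ :* x :+ b₂ :* y))
      := a₂ :* b₁ :* (a :* x :+ b :* y) :+ (a :* b₂ :* (a₁ :* x :+ b₁ :* y) :+ a₁ :* b :* (a₂ :* x :+ b₂ :* y)))
      refl a b a₁ b₁ a₂ b₂ (u i) (v i)

    cramer : ∀ i → D * ξ i ≡ A * ξ₁ i + B * ξ₂ i
    cramer i = begin
      D * ξ i
        ≡⟨ [y-z]x≈yx-zx (ξ i) _ _ ⟩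
      a₁ * b₂ * ξ i - a₂ * b₁ * ξ i
        ≡⟨ x+y≡x′+y′⇒x-x′≡y′-y (balanced i) ⟩
      (a * b₂ * ξ₁ i + a₁ * b * ξ₂ i) - (a₂ * b * ξ₁ i + a * b₁ * ξ₂ i)
        ≡⟨ sym ([a-a′]x+[b-b′]y≡[ax+by]-[a′x+b′y] _ _ _ _ _ _) ⟩
      A * ξ₁ i + B * ξ₂ i
        ∎

module AutomorphismProperties (K : FiniteField) {σ : FiniteField.F K → FiniteField.F K} (aut : IsAutomorphism K σ) where
  open FieldProperties K
  open VectorProperties K
  open IsAutomorphism aut
  open ≡-Reasoning

  σ⁻¹ : F → F
  σ⁻¹ = proj₁ bij

  σ⁻¹∘σ : ∀ x → σ⁻¹ (σ x) ≡ x
  σ⁻¹∘σ = proj₁ (proj₂ bij)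

  σ∘σ⁻¹ : ∀ x → σ (σ⁻¹ x) ≡ x
  σ∘σ⁻¹ = proj₂ (proj₂ bij)

  σ-injective : ∀ {x y} → σ x ≡ σ y → x ≡ y
  σ-injective {x} {y} σx≡σy = trans (sym (σ⁻¹∘σ x)) (trans (cong σ⁻¹ σx≡σy) (σ⁻¹∘σ y))

  σ-0 : σ 0# ≡ 0#
  σ-0 = x+x≈x⇒x≈0 (σ 0#) (trans (sym (hom-+ 0# 0#)) (cong σ (+-identityʳ 0#)))

  σ-≢0 : ∀ {x} → x ≢ 0# → σ x ≢ 0#
  σ-≢0 x≢0 σx≡0 = x≢0 (σ-injective (trans σx≡0 (sym σ-0)))

  σ-fixes-ratio : ∀ {x y} (y≢0 : y ≢ 0#) → σ x * y ≡ σ y * x → σ (x * inv y y≢0) ≡ x * inv y y≢0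
  σ-fixes-ratio {x} {y} y≢0 σx*y≡σy*x = *-cancelˡ (σ-≢0 y≢0) (begin
    σ y * σ (x * y⁻¹)     ≡⟨ sym (hom-* y _) ⟩
    σ (y * (x * y⁻¹))     ≡⟨ cong σ (trans (*-comm y _) (x*y⁻¹*y≡x y≢0)) ⟩
    σ x                   ≡⟨ sym (x*y*y⁻¹≡x y≢0) ⟩
    σ x * y * y⁻¹         ≡⟨ cong (_* y⁻¹) σx*y≡σy*x ⟩
    σ y * x * y⁻¹         ≡⟨ *-assoc _ _ _ ⟩
    σ y * (x * y⁻¹)       ∎)
    where
    y⁻¹ = inv y y≢0

  cross-ratio-σ-invariant : ∀ {c₁ c₂ α β c α′ β′ c′} → c ≢ 0# → c′ ≢ 0# →
                            α * c₁ ≡ c * σ α → β * c₂ ≡ c * σ β →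
                            α′ * c₁ ≡ c′ * σ α′ → β′ * c₂ ≡ c′ * σ β′ →
                            σ (α * β′) * (β * α′) ≡ σ (β * α′) * (α * β′)
  cross-ratio-σ-invariant {c₁} {c₂} {α} {β} {c} {α′} {β′} {c′} c≢0 c′≢0 α-eigen β-eigen α′-eigen β′-eigen =
    *-cancelˡ (*-≢0 c≢0 c′≢0) (begin
      c * c′ * (σ (α * β′) * (β * α′))
        ≡⟨ cong (λ t → c * c′ * (t * (β * α′))) (hom-* α β′) ⟩
      c * c′ * (σ α * σ β′ * (β * α′))
        ≡⟨ solve 6 (λ c c′ a b′ x y → c :* c′ :* (a :* b′ :* (x :* y)) := c :* a :* (c′ :* b′) :* (x :* y))
                   refl c c′ (σ α) (σ β′) β α′ ⟩
      c * σ α * (c′ * σ β′) * (β * α′)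
        ≡⟨ cong₂ (λ p q → p * q * (β * α′)) (sym α-eigen) (sym β′-eigen) ⟩
      α * c₁ * (β′ * c₂) * (β * α′)
        ≡⟨ solve 6 (λ α c₁ β′ c₂ β α′ → α :* c₁ :* (β′ :* c₂) :* (β :* α′)
                                     := β :* c₂ :* (α′ :* c₁) :* (α :* β′))
                   refl α c₁ β′ c₂ β α′ ⟩
      β * c₂ * (α′ * c₁) * (α * β′)
        ≡⟨ cong₂ (λ p q → p * q * (α * β′)) β-eigen α′-eigen ⟩
      c * σ β * (c′ * σ α′) * (α * β′)
        ≡⟨ solve 6 (λ c c′ b a′ x y → c :* b :* (c′ :* a′) :* (x :* y) := c :* c′ :* (b :* a′ :* (x :* y)))
                   refl c c′ (σ β) (σ α′) α β′ ⟩
      c * c′ * (σ β * σ α′ * (α * β′))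
        ≡⟨ cong (λ t → c * c′ * (t * (α * β′))) (sym (hom-* β α′)) ⟩
      c * c′ * (σ (β * α′) * (α * β′))
        ∎)

  ^ᵛ-comb : ∀ {m} a b (ξ η : Vect K m) → (comb a ξ b η ^ᵛ σ) ≈ᵥ comb (σ a) (ξ ^ᵛ σ) (σ b) (η ^ᵛ σ)
  ^ᵛ-comb a b ξ η i = trans (hom-+ _ _) (cong₂ _+_ (hom-* a (ξ i)) (hom-* b (η i)))

  LinIndep₂-^ᵛ : ∀ {m} {ξ η : Vect K m} → LinIndep₂ K ξ η → LinIndep₂ K (ξ ^ᵛ σ) (η ^ᵛ σ)
  LinIndep₂-^ᵛ {ξ = ξ} {η} indep a b aξᵠ+bηᵠ≈0
    with indep (σ⁻¹ a) (σ⁻¹ b) (λ i → σ-injective (begin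
      σ (σ⁻¹ a * ξ i + σ⁻¹ b * η i)
        ≡⟨ ^ᵛ-comb (σ⁻¹ a) (σ⁻¹ b) ξ η i ⟩
      σ (σ⁻¹ a) * σ (ξ i) + σ (σ⁻¹ b) * σ (η i)
        ≡⟨ cong₂ (λ p q → p * σ (ξ i) + q * σ (η i)) (σ∘σ⁻¹ a) (σ∘σ⁻¹ b) ⟩
      a * σ (ξ i) + b * σ (η i)
        ≡⟨ aξᵠ+bηᵠ≈0 i ⟩
      0#
        ≡⟨ sym σ-0 ⟩
      σ 0#
        ∎))
  ... | σ⁻¹a≡0 , σ⁻¹b≡0 = σ⁻¹x≡0⇒x≡0 σ⁻¹a≡0 , σ⁻¹x≡0⇒x≡0 σ⁻¹b≡0
    where
    σ⁻¹x≡0⇒x≡0 : ∀ {x} → σ⁻¹ x ≡ 0# → x ≡ 0#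
    σ⁻¹x≡0⇒x≡0 {x} σ⁻¹x≡0 = trans (sym (σ∘σ⁻¹ x)) (trans (cong σ σ⁻¹x≡0) σ-0)

module SemilinearEigenvectors (K : FiniteField) {σ : FiniteField.F K → FiniteField.F K} (aut : IsAutomorphism K σ)
                              {m : ℕ} (M : Mat K m) where
  open FieldProperties K
  open VectorProperties K
  open AutomorphismProperties K aut
  open IsAutomorphism aut
  open ≡-Reasoning

  Eigen : F → Vect K m → Set
  Eigen c ξ = (ξ ⋆ M) ≈ᵥ (c · (ξ ^ᵛ σ))

  eigen-coefficients : ∀ {ξ₁ ξ₂ ξ c₁ c₂ c α β} → LinIndep₂ K ξ₁ ξ₂ → Eigen c₁ ξ₁ → Eigen c₂ ξ₂ →
                       ξ ≈ᵥ comb α ξ₁ β ξ₂ → Eigen c ξ → α * c₁ ≡ c * σ α × β * c₂ ≡ c * σ β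
  eigen-coefficients {ξ₁} {ξ₂} {ξ} {c₁} {c₂} {c} {α} {β} indep e₁ e₂ ξ≈ e =
    LinIndep₂-unique (LinIndep₂-^ᵛ indep) λ i → begin
      α * c₁ * σ (ξ₁ i) + β * c₂ * σ (ξ₂ i)
        ≡⟨ solve 6 (λ α β c₁ c₂ x y → α :* c₁ :* x :+ β :* c₂ :* y := α :* (c₁ :* x) :+ β :* (c₂ :* y))
                   refl α β c₁ c₂ (σ (ξ₁ i)) (σ (ξ₂ i)) ⟩
      α * (c₁ * σ (ξ₁ i)) + β * (c₂ * σ (ξ₂ i))
        ≡⟨ sym (cong₂ (λ p q → α * p + β * q) (e₁ i) (e₂ i)) ⟩
      α * (ξ₁ ⋆ M) i + β * (ξ₂ ⋆ M) i
        ≡⟨ sym (⋆-comb M α β ξ₁ ξ₂ i) ⟩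
      (comb α ξ₁ β ξ₂ ⋆ M) i
        ≡⟨ sym (⋆-cong M ξ≈ i) ⟩
      (ξ ⋆ M) i
        ≡⟨ e i ⟩
      c * σ (ξ i)
        ≡⟨ cong (c *_) (trans (cong σ (ξ≈ i)) (^ᵛ-comb α β ξ₁ ξ₂ i)) ⟩
      c * (σ α * σ (ξ₁ i) + σ β * σ (ξ₂ i))
        ≡⟨ solve 5 (λ c a b x y → c :* (a :* x :+ b :* y) := c :* a :* x :+ c :* b :* y)
                   refl c (σ α) (σ β) (σ (ξ₁ i)) (σ (ξ₂ i)) ⟩
      c * σ α * σ (ξ₁ i) + c * σ β * σ (ξ₂ i)
        ∎

  eigenpencil⇒σ≗id : ∀ {ξ η c₁ c₂} → LinIndep₂ K ξ η → Eigen c₁ ξ → c₁ ≢ 0# → Eigen c₂ η →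
                     (∀ t → Cond K σ M (comb 1# ξ t η)) → ∀ x → σ x ≡ x
  eigenpencil⇒σ≗id {c₁ = c₁} {c₂} indep e₁ c₁≢0 e₂ cond x = sym (*-cancelˡ c₁≢0 (begin
    c₁ * x                 ≡⟨ *-comm c₁ x ⟩
    x * c₁                 ≡⟨ cong (x *_) c₁≡c₂ ⟩
    x * c₂                 ≡⟨ proj₂ (coefficients x) ⟩
    eigenvalue x * σ x     ≡⟨ cong (_* σ x) (sym (c₁≡eigenvalue x)) ⟩
    c₁ * σ x               ∎))
    where
    eigenvalue : F → F
    eigenvalue t = proj₁ (cond t)

    coefficients : ∀ t → 1# * c₁ ≡ eigenvalue t * σ 1# × t * c₂ ≡ eigenvalue t * σ t
    coefficients t = eigen-coefficients indep e₁ e₂ (λ _ → refl) (proj₂ (proj₂ (cond t)))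

    c₁≡eigenvalue : ∀ t → c₁ ≡ eigenvalue t
    c₁≡eigenvalue t = begin
      c₁                     ≡⟨ sym (*-identityˡ c₁) ⟩
      1# * c₁                ≡⟨ proj₁ (coefficients t) ⟩
      eigenvalue t * σ 1#    ≡⟨ cong (eigenvalue t *_) hom-1 ⟩
      eigenvalue t * 1#      ≡⟨ *-identityʳ _ ⟩
      eigenvalue t           ∎

    c₁≡c₂ : c₁ ≡ c₂
    c₁≡c₂ = begin
      c₁                     ≡⟨ c₁≡eigenvalue 1# ⟩
      eigenvalue 1#          ≡⟨ sym (*-identityʳ _) ⟩
      eigenvalue 1# * 1#     ≡⟨ cong (eigenvalue 1# *_) (sym hom-1) ⟩
      eigenvalue 1# * σ 1#   ≡⟨ sym (proj₂ (coefficients 1#)) ⟩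
      1# * c₂                ≡⟨ *-identityˡ c₂ ⟩
      c₂                     ∎

  eigen-subspace-dim≤1 : ¬ (∀ x → σ x ≡ x) → (W : Vect K m → Set) → IsSubspace K W →
                         (∀ ξ → W ξ → NonZero K ξ → Cond K σ M ξ) → DimAtMost1 K W
  eigen-subspace-dim≤1 σ≢id _ W-subspace W-eigen ξ η Wξ Wη indep =
    σ≢id (eigenpencil⇒σ≗id indep (proj₂ (proj₂ condξ)) (proj₁ (proj₂ condξ)) (proj₂ (proj₂ condη)) cond-comb)
    where
    open IsSubspace W-subspace

    condξ : Cond K σ M ξ
    condξ = W-eigen ξ Wξ (LinIndep₂⇒NonZeroˡ indep)

    condη : Cond K σ M η
    condη = W-eigen η Wη (LinIndep₂⇒NonZeroʳ indep)

    cond-comb : ∀ t → Cond K σ M (comb 1# ξ t η)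
    cond-comb t = W-eigen _ (+-closed _ _ (·-closed 1# ξ Wξ) (·-closed t η Wη))
                            (λ ξ+tη≈0 → 0≢1 (sym (proj₁ (indep 1# t ξ+tη≈0))))

  module Pencil {ξ₁ ξ₂ : Vect K m} (indep : LinIndep₂ K ξ₁ ξ₂)
                {c₁ c₂ : F} (e₁ : Eigen c₁ ξ₁) (e₂ : Eigen c₂ ξ₂) where

    record PencilPoint (ξ : Vect K m) : Set where
      field
        α β c   : F
        ξ≈      : ξ ≈ᵥ comb α ξ₁ β ξ₂
        nonzero : NonZero K ξ
        c≢0     : c ≢ 0#
        β≢0     : β ≢ 0#
        α-eigen : α * c₁ ≡ c * σ α
        β-eigen : β * c₂ ≡ c * σ β

    pencilPoint : ∀ {ξ} → InSpan ξ₁ ξ₂ ξ → NonZero K ξ → Cond K σ M ξ → ¬ SamePoint K ξ₁ ξ → PencilPoint ξ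
    pencilPoint (α , β , ξ≈) ξ≢0 (c , c≢0 , e) ξ₁≁ξ = record
      { α = α ; β = β ; c = c ; ξ≈ = ξ≈ ; nonzero = ξ≢0 ; c≢0 = c≢0 ; β≢0 = β≢0
      ; α-eigen = proj₁ coefficients ; β-eigen = proj₂ coefficients }
      where
      coefficients = eigen-coefficients indep e₁ e₂ ξ≈ e

      β≢0 : β ≢ 0#
      β≢0 β≡0 = ξ₁≁ξ (SamePoint-sym (LinIndep₂⇒NonZeroˡ indep)
                        (≈·⇒SamePoint ξ≢0 (λ i → trans (ξ≈ i) (comb-0ʳ α β ξ₁ ξ₂ β≡0 i))))

    open PencilPoint

    α≢0 : ∀ {ξ} (p : PencilPoint ξ) → ¬ SamePoint K ξ₂ ξ → α p ≢ 0#
    α≢0 p ξ₂≁ξ α≡0 = ξ₂≁ξ (SamePoint-sym (LinIndep₂⇒NonZeroʳ indep)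
                             (≈·⇒SamePoint (nonzero p) (λ i → trans (ξ≈ p i) (comb-0ˡ (α p) (β p) ξ₁ ξ₂ α≡0 i))))

    module CrossRatio {ξ₀} (base : PencilPoint ξ₀) (α₀≢0 : α base ≢ 0#) where

      βα₀≢0 : ∀ {ξ} (p : PencilPoint ξ) → β p * α base ≢ 0#
      βα₀≢0 p = *-≢0 (β≢0 p) α₀≢0

      crossRatio : ∀ {ξ} → PencilPoint ξ → Fix K σ
      crossRatio p = α p * β base * inv (β p * α base) (βα₀≢0 p)
                   , σ-fixes-ratio (βα₀≢0 p)
                       (cross-ratio-σ-invariant (c≢0 p) (c≢0 base) (α-eigen p) (β-eigen p) (α-eigen base) (β-eigen base))

      crossRatio-injective : ∀ {ξ η} (p : PencilPoint ξ) (q : PencilPoint η) →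
                             crossRatio p ≡ crossRatio q → SamePoint K ξ η
      crossRatio-injective p q same = proportional⇒SamePoint (nonzero p) (β≢0 q) (ξ≈ p) (ξ≈ q)
        (*-cancelˡ (*-≢0 (β≢0 base) α₀≢0) (begin
          β₀ * α₀ * (α p * β q)
            ≡⟨ solve 4 (λ β₀ α₀ a b → β₀ :* α₀ :* (a :* b) := a :* β₀ :* (b :* α₀)) refl β₀ α₀ (α p) (β q) ⟩
          α p * β₀ * (β q * α₀)
            ≡⟨ x*y⁻¹≡x′*y′⁻¹⇒x*y′≡x′*y (βα₀≢0 p) (βα₀≢0 q) (cong proj₁ same) ⟩
          α q * β₀ * (β p * α₀)
            ≡⟨ solve 4 (λ β₀ α₀ a b → a :* β₀ :* (b :* α₀) := β₀ :* α₀ :* (a :* b)) refl β₀ α₀ (α q) (β p) ⟩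
          β₀ * α₀ * (α q * β p)
            ∎))
        where
        α₀ = α base
        β₀ = β base

  eigenpoints-on-line≤ : ∀ s → Fix K σ ↔ Fin s →
                         (U : Vect K m → Set) {u v : Vect K m} → (∀ ξ → U ξ → InSpan u v ξ) →
                         (ps : List (Vect K m)) → All (λ ξ → U ξ × NonZero K ξ × Cond K σ M ξ) ps →
                         AllPairs (λ ξ η → ¬ SamePoint K ξ η) ps → length ps ≤ suc s
  eigenpoints-on-line≤ _ _     _ _ []           _ _ = z≤n
  eigenpoints-on-line≤ _ _     _ _ (_ ∷ [])     _ _ = s≤s z≤n
  eigenpoints-on-line≤ _ Fix↔ _ _ (_ ∷ _ ∷ []) _ _ = s≤s (≤-trans (s≤s z≤n) (toℕ<n (Inverse.to Fix↔ (0# , σ-0))))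
  eigenpoints-on-line≤ _ Fix↔ U U⊆span (ξ₁ ∷ ξ₂ ∷ ξ₃ ∷ ξs)
                       ((U₁ , ξ₁≢0 , c₁ , _ , e₁) ∷ hyps@((U₂ , ξ₂≢0 , c₂ , _ , e₂) ∷ _))
                       (ξ₁≁ ∷ separated@((ξ₂≁ξ₃ ∷ _) ∷ _)) =
    s≤s (separated⇒length≤ Fix↔ crossRatio crossRatio-injective points separated)
    where
    indep : LinIndep₂ K ξ₁ ξ₂
    indep = ¬SamePoint⇒LinIndep₂ ξ₁≢0 ξ₂≢0 (All.head ξ₁≁)

    open Pencil indep e₁ e₂

    toPencilPoint : ∀ {ξ} → (U ξ × NonZero K ξ × Cond K σ M ξ) × ¬ SamePoint K ξ₁ ξ → PencilPoint ξ
    toPencilPoint ((Uξ , ξ≢0 , cond) , ξ₁≁ξ) =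
      pencilPoint (span₂-exchange indep (U⊆span _ U₁) (U⊆span _ U₂) (U⊆span _ Uξ)) ξ≢0 cond ξ₁≁ξ

    points : All PencilPoint (ξ₂ ∷ ξ₃ ∷ ξs)
    points = All.zipWith toPencilPoint (hyps , ξ₁≁)

    base : PencilPoint ξ₃
    base = All.head (All.tail points)

    open CrossRatio base (α≢0 base ξ₂≁ξ₃)

lemma3p8 : (K : FiniteField) → let open FiniteField K using (F) in
    (σ : F → F) → IsAutomorphism K σ → ¬ (∀ x → σ x ≡ x) →
    (s : ℕ) → Fix K σ ↔ Fin s →
    (n : ℕ) → (M : Mat K (suc n)) → Invertible K M →
      ((W : Vect K (suc n) → Set) → IsSubspace K W →
         (∀ ξ → W ξ → NonZero K ξ → Cond K σ M ξ) →
         DimAtMost1 K W)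
    × ((U : Vect K (suc n) → Set) → IsSubspace K U → Dim2 K U →
         (ps : List (Vect K (suc n))) →
         All (λ ξ → U ξ × NonZero K ξ × Cond K σ M ξ) ps →
         AllPairs (λ ξ η → ¬ SamePoint K ξ η) ps →
         length ps ≤ suc s)
lemma3p8 K σ aut σ≢id s Fix↔ n M _ =
    eigen-subspace-dim≤1 σ≢id
  , λ U _ (_ , _ , _ , U⇔span) → eigenpoints-on-line≤ s Fix↔ U (λ ξ → proj₁ (U⇔span ξ))
  where
  open SemilinearEigenvectors K aut M
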